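{- For any integers $r,s\ge 0$ and any complex number $x\neq 1$, $$\sum_{k=0}^{r}\binom{r+s-k}{s}\left(\frac{x}{x-1}\right)^k=\frac{x^{r+s+1}}{(x-1)^r}+(1-x)\sum_{k=0}^{s}\binom{r+s-k}{r}x^k,$$ where $\binom{n}{k}$ is the usual binomial coefficient. -}

module Defs where

open import Level using (Level)
open import Data.Nat.Base using (ℕ; zero; suc)
open import Algebra.Bundles using (CommutativeRing)

sumUpTo : ∀ {c ℓ : Level} (R : CommutativeRing c ℓ) →
          (ℕ → CommutativeRing.Carrier R) → ℕ → CommutativeRing.Carrier R
sumUpTo R f zero    = f zero
sumUpTo R f (suc n) = sumUpTo R f n + f (suc n)
  where open CommutativeRing R

-- Peeling off the k = 0 term gives the recursion
-- B_z(m+1, n) = C(m+n+1, n) + z B_z(m, n) for B_z(m, n) = Σ_{k ≤ m} C(m+n−k, n) z^k.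
-- Induct on r. For r = 0 the identity is the geometric sum (1−x) Σ_{k ≤ s} x^k = 1 − x^{s+1}.
-- In the step, multiplying by z = x/(x−1) and using (1−x)/(x−1) = −1 reduces it to
-- (1−x) B_x(s, r+1) + x B_x(s, r) = C(r+s+1, s), which follows from Pascal's rule by
-- induction on s.
module Submission where

open import Defs
open import Data.Maybe.Base using (nothing)
open import Data.Nat.Base as ℕ using (ℕ; zero; suc)
import Data.Nat.Properties as ℕ
open import Data.Nat.Combinatorics
  using (_C_; nCn≡1; nCk≡nC[n∸k]; nCk+nC[k+1]≡[n+1]C[k+1])
open import Algebra.Bundles using (CommutativeRing; Semiring)
import Algebra.Definitions.RawSemiring as SemiringDefs
import Algebra.Properties.Ring as RingProperties
import Algebra.Properties.Semiring.Mult as SemiringMult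
import Algebra.Solver.Ring.NaturalCoefficients as NaturalCoefficientsSolver
import Relation.Binary.Reasoning.Setoid as SetoidReasoning
import Relation.Binary.PropositionalEquality as ≡
open ≡ using (_≡_)

[m+n]Cn≡[n+m]Cm : ∀ m n → (m ℕ.+ n) C n ≡ (n ℕ.+ m) C m
[m+n]Cn≡[n+m]Cm m n = ≡.trans (nCk≡nC[n∸k] (ℕ.m≤n+m n m))
  (≡.trans (≡.cong ((m ℕ.+ n) C_) (ℕ.m+n∸n≡m m n)) (≡.cong (_C m) (ℕ.+-comm m n)))

module _ {c ℓ} (R : CommutativeRing c ℓ) where
  open CommutativeRing R
  open SemiringDefs (Semiring.rawSemiring semiring)
  open RingProperties ring using (//-rightDividesˡ; //-rightDividesʳ;
    ⁻¹-anti-homo‿-; -‿distribʳ-*; -1*x≈-x)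
  open SemiringMult semiring using (×-congˡ; ×-homo-1; ×-homo-+; ×-comm-*)
  open SetoidReasoning setoid
  open NaturalCoefficientsSolver commutativeSemiring (λ _ _ → nothing)
    using (solve; _:+_; _:*_; _:=_)

  sumUpTo-cong : ∀ {f g} n → (∀ k → f k ≈ g k) → sumUpTo R f n ≈ sumUpTo R g n
  sumUpTo-cong zero    f≈g = f≈g 0
  sumUpTo-cong (suc n) f≈g = +-cong (sumUpTo-cong n f≈g) (f≈g (suc n))

  sumUpTo-head : ∀ f n → sumUpTo R f (suc n) ≈ f 0 + sumUpTo R (λ k → f (suc k)) n
  sumUpTo-head f zero    = refl
  sumUpTo-head f (suc n) = trans (+-congʳ (sumUpTo-head f n)) (+-assoc _ _ _)

  *-distribˡ-sumUpTo : ∀ a f n → a * sumUpTo R f n ≈ sumUpTo R (λ k → a * f k) n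
  *-distribˡ-sumUpTo a f zero    = refl
  *-distribˡ-sumUpTo a f (suc n) =
    trans (distribˡ a _ _) (+-congʳ (*-distribˡ-sumUpTo a f n))

  [1-x]*a+x*a≈a : ∀ x a → (1# - x) * a + x * a ≈ a
  [1-x]*a+x*a≈a x a = begin
    (1# - x) * a + x * a  ≈⟨ distribʳ a (1# - x) x ⟨
    (1# - x + x) * a      ≈⟨ *-congʳ (//-rightDividesˡ x 1#) ⟩
    1# * a                ≈⟨ *-identityˡ a ⟩
    a                     ∎

  u*[1-x]≈-1 : ∀ {x u} → (x - 1#) * u ≈ 1# → u * (1# - x) ≈ - 1#
  u*[1-x]≈-1 {x} {u} [x-1]*u≈1 = begin
    u * (1# - x)      ≈⟨ *-congˡ (⁻¹-anti-homo‿- x 1#) ⟨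
    u * - (x - 1#)    ≈⟨ -‿distribʳ-* u (x - 1#) ⟨
    - (u * (x - 1#))  ≈⟨ -‿cong (*-comm u (x - 1#)) ⟩
    - ((x - 1#) * u)  ≈⟨ -‿cong [x-1]*u≈1 ⟩
    - 1#              ∎

  geometricSum : ∀ x n → (1# - x) * sumUpTo R (x ^_) n + x ^ suc n ≈ 1#
  geometricSum x zero    = [1-x]*a+x*a≈a x 1#
  geometricSum x (suc n) = begin
    (1# - x) * (S + X) + x * X        ≈⟨ solve 4 (λ w S X x → w :* (S :+ X) :+ x :* X
                                           := w :* S :+ (w :* X :+ x :* X)) refl (1# - x) S X x ⟩
    (1# - x) * S + ((1# - x) * X + x * X)  ≈⟨ +-congˡ ([1-x]*a+x*a≈a x X) ⟩
    (1# - x) * S + X                  ≈⟨ geometricSum x n ⟩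
    1#                                ∎
    where
    S X : Carrier
    S = sumUpTo R (x ^_) n
    X = x ^ suc n

  -- The left side of the theorem is binomialSum (x * u) r s; the sum on the right is
  -- binomialSum x s r once r + s is commuted.
  binomialSum : Carrier → ℕ → ℕ → Carrier
  binomialSum z m n = sumUpTo R (λ k → ((m ℕ.+ n ℕ.∸ k) C n) × (z ^ k)) m

  binomialSum-zeroˡ : ∀ z n → binomialSum z 0 n ≈ 1#
  binomialSum-zeroˡ z n = trans (×-congˡ (nCn≡1 n)) (×-homo-1 1#)

  binomialSum-zeroʳ : ∀ z m → binomialSum z m 0 ≈ sumUpTo R (z ^_) m
  binomialSum-zeroʳ z m = sumUpTo-cong m (λ k → ×-homo-1 (z ^ k))

  binomialSum-suc : ∀ z m n →
    binomialSum z (suc m) n ≈ ((suc m ℕ.+ n) C n) × 1# + z * binomialSum z m n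
  binomialSum-suc z m n = begin
    binomialSum z (suc m) n
      ≈⟨ sumUpTo-head _ m ⟩
    ((suc m ℕ.+ n) C n) × 1# + sumUpTo R (λ k → ((m ℕ.+ n ℕ.∸ k) C n) × (z * z ^ k)) m
      ≈⟨ +-congˡ (sumUpTo-cong m (λ k → ×-comm-* ((m ℕ.+ n ℕ.∸ k) C n) z (z ^ k))) ⟨
    ((suc m ℕ.+ n) C n) × 1# + sumUpTo R (λ k → z * (((m ℕ.+ n ℕ.∸ k) C n) × z ^ k)) m
      ≈⟨ +-congˡ (*-distribˡ-sumUpTo z _ m) ⟨
    ((suc m ℕ.+ n) C n) × 1# + z * binomialSum z m n
      ∎

  binomialSum-pascal : ∀ x m n →
    (1# - x) * binomialSum x n (suc m) + x * binomialSum x n m ≈ ((suc n ℕ.+ m) C suc m) × 1#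
  binomialSum-pascal x m zero = begin
    (1# - x) * binomialSum x 0 (suc m) + x * binomialSum x 0 m
      ≈⟨ +-cong (*-congˡ (binomialSum-zeroˡ x (suc m))) (*-congˡ (binomialSum-zeroˡ x m)) ⟩
    (1# - x) * 1# + x * 1#  ≈⟨ [1-x]*a+x*a≈a x 1# ⟩
    1#                      ≈⟨ binomialSum-zeroˡ x (suc m) ⟨
    (suc m C suc m) × 1#    ∎
  binomialSum-pascal x m (suc n) = begin
    (1# - x) * binomialSum x (suc n) (suc m) + x * binomialSum x (suc n) m
      ≈⟨ +-cong (*-congˡ (binomialSum-suc x n (suc m))) (*-congˡ (binomialSum-suc x n m)) ⟩
    (1# - x) * (A + x * N′) + x * (B + x * N)
      ≈⟨ solve 6 (λ w x A B N′ N → w :* (A :+ x :* N′) :+ x :* (B :+ x :* N)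
                  := w :* A :+ x :* (B :+ (w :* N′ :+ x :* N))) refl (1# - x) x A B N′ N ⟩
    (1# - x) * A + x * (B + ((1# - x) * N′ + x * N))
      ≈⟨ +-congˡ (*-congˡ (+-congˡ (binomialSum-pascal x m n))) ⟩
    (1# - x) * A + x * (B + D)
      ≈⟨ +-cong (*-congˡ A≈T) (*-congˡ B+D≈T) ⟩
    (1# - x) * T + x * T
      ≈⟨ [1-x]*a+x*a≈a x T ⟩
    T ∎
    where
    A B D T N′ N : Carrier
    A = ((suc n ℕ.+ suc m) C suc m) × 1#
    B = ((suc n ℕ.+ m) C m) × 1#
    D = ((suc n ℕ.+ m) C suc m) × 1#
    T = ((suc (suc n) ℕ.+ m) C suc m) × 1#
    N′ = binomialSum x n (suc m)
    N = binomialSum x n m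
    A≈T : A ≈ T
    A≈T = ×-congˡ (≡.cong (_C suc m) (ℕ.+-suc (suc n) m))
    B+D≈T : B + D ≈ T
    B+D≈T = trans (sym (×-homo-+ 1# ((suc n ℕ.+ m) C m) ((suc n ℕ.+ m) C suc m)))
                  (×-congˡ (nCk+nC[k+1]≡[n+1]C[k+1] (suc n ℕ.+ m) m))

  module _ {x u : Carrier} ([x-1]*u≈1 : (x - 1#) * u ≈ 1#) where

    binomialSum-identity : ∀ r s →
      binomialSum (x * u) r s ≈ x ^ (r ℕ.+ s ℕ.+ 1) * u ^ r + (1# - x) * binomialSum x s r
    binomialSum-identity zero s = begin
      binomialSum (x * u) 0 s                    ≈⟨ binomialSum-zeroˡ (x * u) s ⟩
      1#                                         ≈⟨ geometricSum x s ⟨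
      (1# - x) * sumUpTo R (x ^_) s + x ^ suc s  ≈⟨ +-comm _ _ ⟩
      x ^ suc s + (1# - x) * sumUpTo R (x ^_) s
        ≈⟨ +-cong x^[s+1]*1≈x^suc[s] (*-congˡ (binomialSum-zeroʳ x s)) ⟨
      x ^ (s ℕ.+ 1) * 1# + (1# - x) * binomialSum x s 0 ∎
      where
      x^[s+1]*1≈x^suc[s] : x ^ (s ℕ.+ 1) * 1# ≈ x ^ suc s
      x^[s+1]*1≈x^suc[s] = trans (*-identityʳ _) (reflexive (≡.cong (x ^_) (ℕ.+-comm s 1)))
    binomialSum-identity (suc r) s = begin
      binomialSum (x * u) (suc r) s
        ≈⟨ binomialSum-suc (x * u) r s ⟩
      lead + (x * u) * binomialSum (x * u) r s
        ≈⟨ +-congˡ (*-congˡ (binomialSum-identity r s)) ⟩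
      lead + (x * u) * (P * Q + (1# - x) * N)
        ≈⟨ solve 7 (λ lead x u P Q w N → lead :+ (x :* u) :* (P :* Q :+ w :* N)
                    := (x :* P) :* (u :* Q) :+ (lead :+ x :* ((u :* w) :* N)))
                 refl lead x u P Q (1# - x) N ⟩
      (x * P) * (u * Q) + (lead + x * ((u * (1# - x)) * N))
        ≈⟨ +-congˡ (+-congˡ (*-congˡ (*-congʳ (u*[1-x]≈-1 [x-1]*u≈1)))) ⟩
      (x * P) * (u * Q) + (lead + x * (- 1# * N))
        ≈⟨ +-congˡ (+-congˡ (trans (*-congˡ (-1*x≈-x N)) (sym (-‿distribʳ-* x N)))) ⟩
      (x * P) * (u * Q) + (lead - x * N)
        ≈⟨ +-congˡ (+-congʳ (trans lead≈pascal (sym (binomialSum-pascal x r s)))) ⟩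
      (x * P) * (u * Q) + ((1# - x) * N′ + x * N - x * N)
        ≈⟨ +-congˡ (//-rightDividesʳ (x * N) ((1# - x) * N′)) ⟩
      (x * P) * (u * Q) + (1# - x) * N′ ∎
      where
      lead P Q N N′ : Carrier
      lead = ((suc r ℕ.+ s) C s) × 1#
      P = x ^ (r ℕ.+ s ℕ.+ 1)
      Q = u ^ r
      N = binomialSum x s r
      N′ = binomialSum x s (suc r)
      lead≈pascal : lead ≈ ((suc s ℕ.+ r) C suc r) × 1#
      lead≈pascal = ×-congˡ (≡.trans ([m+n]Cn≡[n+m]Cm (suc r) s) (≡.cong (_C suc r) (ℕ.+-suc s r)))

corollary3p4 : ∀ {c ℓ} (R : CommutativeRing c ℓ) →
    let open CommutativeRing R
        open SemiringDefs (Semiring.rawSemiring semiring)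
    in (r s : ℕ) (x u : Carrier) → (x - 1#) * u ≈ 1# →
       sumUpTo R (λ k → ((r ℕ.+ s ℕ.∸ k) C s) × ((x * u) ^ k)) r
         ≈ (x ^ (r ℕ.+ s ℕ.+ 1)) * (u ^ r)
           + (1# - x) * sumUpTo R (λ k → ((r ℕ.+ s ℕ.∸ k) C r) × (x ^ k)) s
corollary3p4 R r s x u [x-1]*u≈1 =
  trans (binomialSum-identity R [x-1]*u≈1 r s) (+-congˡ (*-congˡ (sumUpTo-cong R s commute)))
  where
  open CommutativeRing R
  open SemiringDefs (Semiring.rawSemiring semiring)
  open SemiringMult semiring using (×-congˡ)
  commute : ∀ k → ((s ℕ.+ r ℕ.∸ k) C r) × (x ^ k) ≈ ((r ℕ.+ s ℕ.∸ k) C r) × (x ^ k)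
  commute k = ×-congˡ (≡.cong (λ n → (n ℕ.∸ k) C r) (ℕ.+-comm s r))
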